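{- Let $T$ be a homeomorphically irreducible tree and $t$ a $T$-admissible sequence. Then $t$ has no reduction (i.e. there is no $T$-admissible sequence $s$ that is a reduction of $t$) if and only if $t$ is canonical.
   Context: A tree is homeomorphically irreducible if it has no vertex of degree two; $V_{br}(T)$ is its set of branch vertices (degree $\ge 3$); $\mathrm{dist}$ is distance in $T$. A rooted subtree has a designated root $\mathrm{rt}$; $T_\emptyset$ denotes the empty rooted tree; for a rooted tree $R$ and $v\in V(R)$, $R[v]$ is the rooted subtree with root $v$ consisting of $v$ and its descendants in $R$. A $T$-admissible sequence is a finite sequence $t=\langle T_1,\dots,T_l\rangle$ of (possibly empty) rooted subtrees of $T$ whose vertex sets form a partition of $V_{br}(T)$ (empty blocks allowed). Its signature is $\mathrm{sig}_t(v)=\mathrm{dist}(v,\mathrm{rt}(T_i))+i$ for $v\in V(T_i)$. If $s=\langle S_1,\dots,S_l\rangle$ and $t=\langle T_1,\dots,T_l\rangle$ are $T$-admissible of equal length, $s$ is a reduction of $t$ if there are $1\le i<j\le l$, $w\in V(T_i)$, $v\in V(T_j)$ with $w$ adjacent to $v$ such that: $S_k=T_k$ for $k\notin\{i,j\}$; $\mathrm{rt}(S_i)=\mathrm{rt}(T_i)$; $\mathrm{rt}(S_j)=\mathrm{rt}(T_j)$ if $v\ne\mathrm{rt}(T_j)$; $V(S_i)=V(T_i)\cup V(T_j[v])$; $V(S_j)=V(T_j)\setminus V(T_j[v])$; and $\mathrm{sig}_s(v)=\mathrm{sig}_t(v)$. $t$ is canonical if there are no $1\le i<j\le l$, $w\in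 V(T_i)$, $v\in V(T_j)$ with $w$ adjacent to $v$ and $\mathrm{sig}_t(v)=\mathrm{sig}_t(w)+1$. -}

module Defs where

open import Data.Nat using (ℕ; zero; suc; _+_; _≤_; _<_)
open import Data.Fin using (Fin; toℕ)
open import Data.Fin.Subset using (Subset; _∈_; _∉_; ∣_∣)
open import Data.Vec using (tabulate)
open import Data.Bool using (Bool; true; false)
open import Data.Maybe using (Maybe; just; nothing)
open import Data.List using (List; []; _∷_; _++_; length)
open import Data.List.Relation.Unary.Unique.Propositional using (Unique)
open import Data.Product using (Σ; ∃; ∃-syntax; _×_; _,_)
open import Data.Sum using (_⊎_)
open import Data.Unit using (⊤)
open import Data.Empty using (⊥)
open import Relation.Nullary using (¬_)
open import Relation.Binary.PropositionalEquality using (_≡_; _≢_)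
open import Function.Bundles using (_⇔_)

module _ {n : ℕ} (E : Fin n → Fin n → Bool) where

  Adj : Fin n → Fin n → Set
  Adj u v = E u v ≡ true

  Chain : List (Fin n) → Set
  Chain []            = ⊤
  Chain (x ∷ [])      = ⊤
  Chain (x ∷ y ∷ xs)  = Adj x y × Chain (y ∷ xs)

  HasCycle : Set
  HasCycle = Σ (Fin n) λ x → Σ (List (Fin n)) λ xs →
    (2 ≤ length xs) × Unique (x ∷ xs) × Chain (x ∷ xs ++ x ∷ [])

  data WalkIn (P : Fin n → Set) : Fin n → Fin n → Set where
    here : ∀ {u} → P u → WalkIn P u u
    step : ∀ {u w v} → P u → Adj u w → WalkIn P w v → WalkIn P u v

  data Walk : Fin n → Fin n → ℕ → Set where
    here : ∀ {u} → Walk u u 0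
    step : ∀ {u w v k} → Adj u w → Walk w v k → Walk u v (suc k)

  Dist : Fin n → Fin n → ℕ → Set
  Dist u v d = Walk u v d × (∀ k → Walk u v k → d ≤ k)

  degree : Fin n → ℕ
  degree v = ∣ tabulate (E v) ∣

record Tree (n : ℕ) : Set where
  field
    E         : Fin n → Fin n → Bool
    nonempty  : 1 ≤ n
    symmetric : ∀ u v → E u v ≡ E v u
    irreflex  : ∀ v → E v v ≡ false
    connected : ∀ u v → WalkIn E (λ _ → ⊤) u v
    acyclic   : ¬ HasCycle E

open Tree public

module _ {n : ℕ} (T : Tree n) where

  _~_ : Fin n → Fin n → Set
  u ~ v = Adj (E T) u v

  dist : Fin n → Fin n → ℕ → Set
  dist = Dist (E T)

  HomeoIrreducible : Set
  HomeoIrreducible = ∀ v → degree (E T) v ≢ 2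

  Branch : Fin n → Set
  Branch v = 3 ≤ degree (E T) v

-- Rooted subtrees: a vertex set together with a root (nothing for the
-- empty rooted tree T_∅).  A subtree of a tree is determined by its
-- vertex set (it is the induced subgraph, which must be connected).

record RSub (n : ℕ) : Set where
  constructor rsub
  field
    verts : Subset n
    root  : Maybe (Fin n)

open RSub public

module _ {n : ℕ} (T : Tree n) where

  IsRootedSubtree : RSub n → Set
  IsRootedSubtree R =
      (root R ≡ nothing → ∀ v → v ∉ verts R)
    × (∀ r → root R ≡ just r → r ∈ verts R)
    × (∀ v → v ∈ verts R → ∃[ r ] root R ≡ just r)
    × (∀ u v → u ∈ verts R → v ∈ verts R → WalkIn (E T) (_∈ verts R) u v)

  -- u ∈ V(R[v]): u is a vertex of R and v lies on the (unique) path of T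
  -- (equivalently of R) from the root of R to u, i.e.
  -- dist(rt, u) = dist(rt, v) + dist(v, u).
  InDesc : RSub n → Fin n → Fin n → Set
  InDesc R v u = u ∈ verts R × Σ (Fin n) λ r → root R ≡ just r ×
    Σ ℕ λ a → Σ ℕ λ b → Σ ℕ λ c →
      dist T r u a × dist T r v b × dist T v u c × a ≡ b + c

  -- T-admissible sequences of length l, indexed by Fin l
  -- (position i : Fin l is the paper's index toℕ i + 1)
  Admissible : {l : ℕ} → (Fin l → RSub n) → Set
  Admissible {l} t =
      (∀ i → IsRootedSubtree (t i))
    × (∀ v → Branch T v → ∃[ i ] v ∈ verts (t i))
    × (∀ i v → v ∈ verts (t i) → Branch T v)
    × (∀ i j v → v ∈ verts (t i) → v ∈ verts (t j) → i ≡ j)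

  Sig : {l : ℕ} → (Fin l → RSub n) → Fin n → ℕ → Set
  Sig {l} t v m = Σ (Fin l) λ i → v ∈ verts (t i) ×
    Σ (Fin n) λ r → root (t i) ≡ just r ×
    Σ ℕ λ d → dist T v r d × m ≡ d + suc (toℕ i)

  Reduction : {l : ℕ} → (s t : Fin l → RSub n) → Set
  Reduction {l} s t = Σ (Fin l) λ i → Σ (Fin l) λ j →
    Σ (Fin n) λ w → Σ (Fin n) λ v →
      (toℕ i < toℕ j) × w ∈ verts (t i) × v ∈ verts (t j) × Adj (E T) w v
    × (∀ k → k ≢ i → k ≢ j → s k ≡ t k)
    × root (s i) ≡ root (t i)
    × (root (t j) ≢ just v → root (s j) ≡ root (t j))
    × (∀ u → (u ∈ verts (s i)) ⇔ (u ∈ verts (t i) ⊎ InDesc (t j) v u))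
    × (∀ u → (u ∈ verts (s j)) ⇔ (u ∈ verts (t j) × ¬ InDesc (t j) v u))
    × (Σ ℕ λ m → Sig s v m × Sig t v m)

  Canonical : {l : ℕ} → (Fin l → RSub n) → Set
  Canonical {l} t = ¬ (Σ (Fin l) λ i → Σ (Fin l) λ j →
    Σ (Fin n) λ w → Σ (Fin n) λ v → Σ ℕ λ a → Σ ℕ λ b →
      (toℕ i < toℕ j) × w ∈ verts (t i) × v ∈ verts (t j) × Adj (E T) w v
    × Sig t v a × Sig t w b × a ≡ suc b)

-- Moving T_j[v] across an edge wv with w ∈ T_i, i < j, into T_i changes the signature of v
-- to dist(v, rt T_i) + i. In a tree, a connected vertex set containing w but not its
-- neighbour v is reached from v only through w, so dist(v, rt T_i) = dist(w, rt T_i) + 1: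
-- the move keeps sig(v) exactly when sig_t(v) = sig_t(w) + 1. Hence reductions correspond
-- to witnesses of non-canonicity. The moved part and the rest of T_j are again rooted
-- subtrees because a connected vertex set of a tree contains every geodesic between its
-- vertices.

module Submission where

open import Defs
open import Data.Nat using (ℕ; zero; suc; _+_; _≤_; _<_; z≤n; s≤s)
open import Data.Nat.Properties
open import Data.Fin using (Fin; toℕ)
open import Data.Fin.Properties using (any?) renaming (_≟_ to _≟ᶠ_; <⇒≢ to <⇒≢ᶠ)
open import Data.Fin.Subset using (Subset; _∈_; _∉_)
open import Data.Fin.Subset.Properties using (_∈?_)
open import Data.Bool using (Bool; true)
open import Data.Bool.Properties using (T-≡) renaming (_≟_ to _≟ᵇ_)
open import Data.Maybe using (Maybe; just; nothing)
open import Data.Maybe.Properties using (just-injective)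
open import Data.Vec using (tabulate)
open import Data.Vec.Properties using (lookup∘tabulate; []=⇒lookup; lookup⇒[]=)
open import Data.List using (List; []; _∷_; _++_; length)
open import Data.List.Properties using (length-++-≤ʳ)
open import Data.List.Relation.Unary.All as All using (All; []; _∷_)
open import Data.List.Relation.Unary.All.Properties using (¬Any⇒All¬)
open import Data.List.Relation.Unary.Any as Any using (Any)
open import Data.List.Relation.Unary.Unique.Propositional using (Unique)
import Data.List.Relation.Unary.Unique.Propositional.Properties as Unique
open import Data.List.Relation.Unary.AllPairs using ([]; _∷_)
open import Data.Product using (Σ; ∃; ∃-syntax; _×_; _,_; proj₁; proj₂; uncurry)
open import Data.Sum using (_⊎_; inj₁; inj₂)
open import Data.Unit using (tt)
open import Data.Empty using (⊥-elim)
open import Function using (_∘_)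
open import Function.Bundles using (_⇔_; mk⇔; Equivalence)
open import Relation.Nullary using (¬_; Dec; yes; no)
open import Relation.Nullary.Decidable
  using (_×-dec_; _⊎-dec_; ¬?; map′; isYes; toWitness; fromWitness)
open import Relation.Unary using (Decidable)
open import Relation.Binary.PropositionalEquality

least-witness : {Q : ℕ → Set} → Decidable Q → ∀ {K} → Q K →
                Σ ℕ λ d → Q d × (∀ k → Q k → d ≤ k)
least-witness Q? {K} qK with Q? 0
... | yes q0 = 0 , q0 , λ _ _ → z≤n
least-witness Q? {zero}  qK | no ¬q0 = ⊥-elim (¬q0 qK)
least-witness Q? {suc K} qK | no ¬q0 with least-witness (Q? ∘ suc) qK
... | d , qd , least = suc d , qd , λ { zero q → ⊥-elim (¬q0 q) ; (suc k) q → s≤s (least k q) }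

module _ {n : ℕ} {P : Fin n → Set} (P? : Decidable P) where

  subsetOf : Subset n
  subsetOf = tabulate (isYes ∘ P?)

  ∈-subsetOf : ∀ {x} → x ∈ subsetOf ⇔ P x
  ∈-subsetOf {x} = mk⇔
    (λ x∈ → toWitness (Equivalence.from T-≡
                         (trans (sym (lookup∘tabulate _ x)) ([]=⇒lookup x∈))))
    (λ px → lookup⇒[]= x _ (trans (lookup∘tabulate _ x) (Equivalence.to T-≡ (fromWitness px))))

endpoint : ∀ {A : Set} → A → List A → A
endpoint x []       = x
endpoint x (y ∷ ys) = endpoint y ys

endpoint-++ : ∀ {A : Set} (x : A) xs y ys → endpoint x (xs ++ y ∷ ys) ≡ endpoint y ys
endpoint-++ x []       y ys = refl
endpoint-++ x (_ ∷ xs) y ys = endpoint-++ _ xs y ys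

module TreeGeometry {n : ℕ} (T : Tree n) where

  G : Fin n → Fin n → Bool
  G = E T

  infix 4 _⌢_
  _⌢_ : Fin n → Fin n → Set
  _⌢_ = Adj G

  private variable
    u v w x r : Fin n
    a b k l : ℕ
    P Q : Fin n → Set
    R : RSub n
    S : Subset n

  ⌢-sym : u ⌢ v → v ⌢ u
  ⌢-sym {u} {v} u⌢v = trans (symmetric T v u) u⌢v

  walk-++ : Walk G u v a → Walk G v w b → Walk G u w (a + b)
  walk-++ here       q = q
  walk-++ (step e p) q = step e (walk-++ p q)

  walk-∷ʳ : Walk G u v a → v ⌢ w → Walk G u w (suc a)
  walk-∷ʳ here       e = step e here
  walk-∷ʳ (step e p) f = step e (walk-∷ʳ p f)

  walk-reverse : Walk G u v a → Walk G v u a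
  walk-reverse here       = here
  walk-reverse (step e p) = walk-∷ʳ (walk-reverse p) (⌢-sym e)

  walkIn-++ : WalkIn G P u v → WalkIn G P v w → WalkIn G P u w
  walkIn-++ (here _)      q = q
  walkIn-++ (step pu e p) q = step pu e (walkIn-++ p q)

  walkIn-map : (∀ {x} → P x → Q x) → WalkIn G P u v → WalkIn G Q u v
  walkIn-map f (here pu)     = here (f pu)
  walkIn-map f (step pu e p) = step (f pu) e (walkIn-map f p)

  walkIn-∷ʳ : WalkIn G P u v → v ⌢ w → P w → WalkIn G P u w
  walkIn-∷ʳ (here pu)     e pw = step pu e (here pw)
  walkIn-∷ʳ (step pu e p) f pw = step pu e (walkIn-∷ʳ p f pw)

  walkIn-reverse : WalkIn G P u v → WalkIn G P v u
  walkIn-reverse (here pu)     = here pu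
  walkIn-reverse (step pu e p) = walkIn-∷ʳ (walkIn-reverse p) (⌢-sym e) pu

  walkIn⇒walk : WalkIn G P u v → ∃ (Walk G u v)
  walkIn⇒walk (here _)     = 0 , here
  walkIn⇒walk (step _ e p) = suc (proj₁ (walkIn⇒walk p)) , step e (proj₂ (walkIn⇒walk p))

  walk? : ∀ u v k → Dec (Walk G u v k)
  walk? u v zero with u ≟ᶠ v
  ... | yes refl = yes here
  ... | no u≢v   = no λ { here → u≢v refl }
  walk? u v (suc k) =
    map′ (λ (_ , e , p) → step e p) (λ { (step e p) → _ , e , p })
         (any? λ w → (G u w ≟ᵇ true) ×-dec walk? w v k)

  -- δ must not unfold: unification infers its arguments and with-abstraction stays well typed.
  opaque
    shortest-walk : ∀ u v → Σ ℕ (Dist G u v)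
    shortest-walk u v = least-witness (walk? u v) (proj₂ (walkIn⇒walk (connected T u v)))

    δ : Fin n → Fin n → ℕ
    δ u v = proj₁ (shortest-walk u v)

    δ-Dist : Dist G u v (δ u v)
    δ-Dist {u} {v} = proj₂ (shortest-walk u v)

  δ-walk : Walk G u v (δ u v)
  δ-walk = proj₁ δ-Dist

  δ-minimal : Walk G u v k → δ u v ≤ k
  δ-minimal = proj₂ δ-Dist _

  Dist⇒δ : Dist G u v k → k ≡ δ u v
  Dist⇒δ (p , minimal) = ≤-antisym (minimal _ δ-walk) (δ-minimal p)

  δ-sym : δ u v ≡ δ v u
  δ-sym = ≤-antisym (δ-minimal (walk-reverse δ-walk)) (δ-minimal (walk-reverse δ-walk))

  δ-triangle : δ u w ≤ δ u v + δ v w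
  δ-triangle = δ-minimal (walk-++ δ-walk δ-walk)

  δ-step : u ⌢ w → δ u v ≤ suc (δ w v)
  δ-step e = δ-minimal (step e δ-walk)

  δ-refl : δ u u ≡ 0
  δ-refl = n≤0⇒n≡0 (δ-minimal here)

  δ≡0⇒≡ : δ u v ≡ 0 → u ≡ v
  δ≡0⇒≡ {u} {v} δ≡0 with subst (Walk G u v) δ≡0 δ-walk
  ... | here = refl

  record Path (P : Fin n → Set) (u v : Fin n) : Set where
    constructor path
    field
      later  : List (Fin n)
      unique : Unique (u ∷ later)
      chain  : Chain G (u ∷ later)
      inside : All P (u ∷ later)
      ends   : endpoint u later ≡ v

  suffix-path : ∀ {y ys} → Any (x ≡_) (y ∷ ys) → Unique (y ∷ ys) → Chain G (y ∷ ys) →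
                All P (y ∷ ys) → Path P x (endpoint y ys)
  suffix-path {ys = ys} (Any.here refl) un ch al = path ys un ch al refl
  suffix-path {ys = _ ∷ _} (Any.there x∈) (_ ∷ un) (_ , ch) (_ ∷ al) = suffix-path x∈ un ch al

  erase-loops : WalkIn G P u v → Path P u v
  erase-loops (here pu) = path [] ([] ∷ []) tt (pu ∷ []) refl
  erase-loops {u = u} (step pu e p) with erase-loops p
  ... | path ys un ch al refl with Any.any? (u ≟ᶠ_) (_ ∷ ys)
  ...   | yes u∈ = suffix-path u∈ un ch al
  ...   | no u∉  = path (_ ∷ ys) (¬Any⇒All¬ _ u∉ ∷ un) (e , ch) (pu ∷ al) refl

  chain-++ : ∀ xs {y} ys → Chain G (x ∷ xs) → endpoint x xs ⌢ y → Chain G (y ∷ ys) →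
             Chain G (x ∷ xs ++ y ∷ ys)
  chain-++ []       ys _        e c′ = e , c′
  chain-++ (_ ∷ xs) ys (e₀ , c) e c′ = e₀ , chain-++ xs ys c e c′

  -- If p ≢ p′, the two walks joined by the two edges contain a cycle.
  bridge-unique : ∀ {q q′ p′ p} → WalkIn G (¬_ ∘ P) q q′ → WalkIn G P p′ p →
                  p ⌢ q → q′ ⌢ p′ → p ≡ p′
  bridge-unique {q = q} {p′ = p′} {p = p} outer inner p⌢q q′⌢p′ with p ≟ᶠ p′
  ... | yes p≡p′ = p≡p′
  ... | no p≢p′ with erase-loops outer | erase-loops inner
  ...   | path os uo co ao refl | path [] _ _ _ p′≡p = ⊥-elim (p≢p′ (sym p′≡p))
  ...   | path os uo co ao refl | path is@(_ ∷ _) ui ci ai refl =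
    ⊥-elim (acyclic T (q , os ++ p′ ∷ is , long , unique , cycle))
    where
    long : 2 ≤ length (os ++ p′ ∷ is)
    long = ≤-trans (s≤s (s≤s z≤n)) (length-++-≤ʳ (p′ ∷ is) {os})
    unique : Unique (q ∷ os ++ p′ ∷ is)
    unique = Unique.++⁺ uo ui (λ (m₁ , m₂) → All.lookup ao m₁ (All.lookup ai m₂))
    cycle : Chain G (q ∷ (os ++ p′ ∷ is) ++ q ∷ [])
    cycle = chain-++ (os ++ p′ ∷ is) [] (chain-++ os is co q′⌢p′ ci)
                     (subst (_⌢ q) (sym (endpoint-++ q os p′ is)) p⌢q) tt

  record Entry (P : Fin n → Set) (u r : Fin n) (k : ℕ) : Set where
    constructor entry
    field
      {last-out first-in} : Fin n
      {remaining}         : ℕ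
      outside             : WalkIn G (¬_ ∘ P) u last-out
      crossing            : last-out ⌢ first-in
      inside              : P first-in
      rest                : Walk G first-in r remaining
      shorter             : remaining < k

  first-entry : Decidable P → Walk G u r k → ¬ P u → P r → Entry P u r k
  first-entry P? here ¬pu pr = ⊥-elim (¬pu pr)
  first-entry P? (step {w = w} e p) ¬pu pr with P? w
  ... | yes pw = entry (here ¬pu) e pw p ≤-refl
  ... | no ¬pw with first-entry P? p ¬pw pr
  ...   | entry out cross pz rest shorter = entry (step ¬pu e out) cross pz rest (m<n⇒m<1+n shorter)

  Between : Fin n → Fin n → Fin n → Set
  Between u r x = δ u x + δ x r ≡ δ u r

  Connected : (Fin n → Set) → Set
  Connected P = ∀ a b → P a → P b → WalkIn G P a b

  walk-detours : Walk G u r k → WalkIn G (λ x → δ u x + δ x r ≤ k) u r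
  walk-detours here = here (≤-reflexive (cong₂ _+_ δ-refl δ-refl))
  walk-detours {u = u} {r = r} (step e p) =
    step (≤-trans (≤-reflexive (cong (_+ δ u r) δ-refl)) (δ-minimal (step e p))) e
         (walkIn-map (λ le → ≤-trans (+-monoˡ-≤ _ (δ-step e)) (s≤s le)) (walk-detours p))

  geodesic : ∀ u r → WalkIn G (Between u r) u r
  geodesic u r = walkIn-map (λ le → ≤-antisym le δ-triangle) (walk-detours δ-walk)

  -- If x ∉ P, both halves of the geodesic through x re-enter P at the same vertex
  -- (bridge-unique), so the geodesic could be shortcut.
  convex : Decidable P → Connected P → P u → P r → Between u r x → P x
  convex {u = u} {r = r} {x = x} P? conn pu pr between with P? x
  ... | yes px = px
  ... | no ¬px
    with first-entry P? (walk-reverse δ-walk) ¬px pu | first-entry P? δ-walk ¬px pr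
  ...   | entry out₁ cross₁ py to-u a′<a | entry out₂ cross₂ pz to-r b′<b
    with bridge-unique (walkIn-++ (walkIn-reverse out₁) out₂) (conn _ _ pz py)
                       (⌢-sym cross₁) cross₂
  ...     | refl = ⊥-elim (<-irrefl refl (begin-strict
    δ u r                ≤⟨ δ-minimal (walk-++ (walk-reverse to-u) to-r) ⟩
    _                    <⟨ +-mono-< a′<a b′<b ⟩
    δ u x + δ x r        ≡⟨ between ⟩
    δ u r                ∎))
    where open ≤-Reasoning

  -- A geodesic from v to r enters P along an edge, which is vw by bridge-unique.
  δ-across-edge : Decidable P → Connected P → P r → P w → ¬ P v → w ⌢ v →
                  δ v r ≡ suc (δ w r)
  δ-across-edge P? conn pr pw ¬pv w⌢v with first-entry P? δ-walk ¬pv pr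
  ... | entry out cross pz to-r shorter with bridge-unique out (conn _ _ pz pw) w⌢v cross
  ...   | refl = ≤-antisym (δ-step (⌢-sym w⌢v)) (≤-trans (s≤s (δ-minimal to-r)) shorter)

  InDesc⇒δ : root R ≡ just r → InDesc T R v u → δ r u ≡ δ r v + δ v u
  InDesc⇒δ root≡ (_ , _ , root≡′ , _ , _ , _ , Da , Db , Dc , a≡b+c)
    with just-injective (trans (sym root≡′) root≡)
  ... | refl = trans (sym (Dist⇒δ Da)) (trans a≡b+c (cong₂ _+_ (Dist⇒δ Db) (Dist⇒δ Dc)))

  δ⇒InDesc : root R ≡ just r → u ∈ verts R → δ r u ≡ δ r v + δ v u → InDesc T R v u
  δ⇒InDesc root≡ u∈ δ≡ = u∈ , _ , root≡ , _ , _ , _ , δ-Dist , δ-Dist , δ-Dist , δ≡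

  InDesc? : ∀ R → root R ≡ just r → ∀ v → Decidable (InDesc T R v)
  InDesc? {r} R root≡ v u =
    map′ (uncurry (δ⇒InDesc root≡)) (λ d → proj₁ d , InDesc⇒δ root≡ d)
         ((u ∈? verts R) ×-dec (δ r u ≟ δ r v + δ v u))

  InDesc-self : root R ≡ just r → v ∈ verts R → InDesc T R v v
  InDesc-self {r = r} {v = v} root≡ v∈ =
    δ⇒InDesc root≡ v∈ (sym (trans (cong (δ r v +_) δ-refl) (+-identityʳ _)))

  InDesc-root : root R ≡ just r → u ∈ verts R → InDesc T R r u
  InDesc-root {r = r} {u = u} root≡ u∈ = δ⇒InDesc root≡ u∈ (sym (cong (_+ δ r u) δ-refl))

  root-InDesc : root R ≡ just r → InDesc T R v r → v ≡ r
  root-InDesc {r = r} {v = v} root≡ d =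
    sym (δ≡0⇒≡ (m+n≡0⇒m≡0 (δ r v) (trans (sym (InDesc⇒δ root≡ d)) δ-refl)))

  descendants-connected : Connected (_∈ verts R) → root R ≡ just r → v ∈ verts R →
                          InDesc T R v u → WalkIn G (InDesc T R v) u v
  descendants-connected {R} {r} {v} {u} conn root≡ v∈ u-desc = walkIn-map below (geodesic u v)
    where
    open ≤-Reasoning
    below : Between u v x → InDesc T R v x
    below {x} between = δ⇒InDesc root≡ (convex (_∈? verts R) conn (proj₁ u-desc) v∈ between)
                                       (≤-antisym δ-triangle (+-cancelʳ-≤ (δ u x) _ _ far))
      where
      far : δ r v + δ v x + δ u x ≤ δ r x + δ u x
      far = begin
        δ r v + δ v x + δ u x   ≡⟨ +-assoc (δ r v) _ _ ⟩
        δ r v + (δ v x + δ u x) ≡⟨ cong (δ r v +_) (+-comm (δ v x) _) ⟩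
        δ r v + (δ u x + δ v x) ≡⟨ cong (λ d → δ r v + (δ u x + d)) δ-sym ⟩
        δ r v + (δ u x + δ x v) ≡⟨ cong (δ r v +_) (trans between δ-sym) ⟩
        δ r v + δ v u           ≡⟨ InDesc⇒δ root≡ u-desc ⟨
        δ r u                   ≤⟨ δ-triangle ⟩
        δ r x + δ x u           ≡⟨ cong (δ r x +_) δ-sym ⟩
        δ r x + δ u x           ∎

  remainder-connected : Connected (_∈ verts R) → root R ≡ just r → r ∈ verts R →
                        u ∈ verts R → ¬ InDesc T R v u →
                        WalkIn G (λ x → x ∈ verts R × ¬ InDesc T R v x) u r
  remainder-connected {R} {r} {u} {v} conn root≡ r∈ u∈ u-not-desc = walkIn-map above (geodesic u r)
    where
    open ≤-Reasoning
    above : Between u r x → x ∈ verts R × ¬ InDesc T R v x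
    above {x} between = convex (_∈? verts R) conn u∈ r∈ between , λ x-desc →
      u-not-desc (δ⇒InDesc root≡ u∈ (≤-antisym δ-triangle (near x-desc)))
      where
      near : InDesc T R v x → δ r v + δ v u ≤ δ r u
      near x-desc = begin
        δ r v + δ v u           ≤⟨ +-monoʳ-≤ (δ r v) δ-triangle ⟩
        δ r v + (δ v x + δ x u) ≡⟨ +-assoc (δ r v) _ _ ⟨
        δ r v + δ v x + δ x u   ≡⟨ cong (_+ δ x u) (InDesc⇒δ root≡ x-desc) ⟨
        δ r x + δ x u           ≡⟨ trans (+-comm (δ r x) _) (cong₂ _+_ δ-sym δ-sym) ⟩
        δ u x + δ x r           ≡⟨ trans between δ-sym ⟩
        δ r u                   ∎

  rooted-empty : (∀ u → u ∉ S) → IsRootedSubtree T (rsub S nothing)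
  rooted-empty empty = (λ _ → empty) , (λ _ ()) , (λ u u∈ → ⊥-elim (empty u u∈))
                     , (λ u _ u∈ _ → ⊥-elim (empty u u∈))

  rooted-star : r ∈ S → (∀ u → u ∈ S → WalkIn G (_∈ S) u r) →
                IsRootedSubtree T (rsub S (just r))
  rooted-star r∈ star =
      (λ ()) , (λ { _ refl → r∈ }) , (λ _ _ → _ , refl)
    , (λ u u′ u∈ u′∈ → walkIn-++ (star u u∈) (walkIn-reverse (star u′ u′∈)))

  Sig-intro : {t : Fin l → RSub n} {i : Fin l} → v ∈ verts (t i) → root (t i) ≡ just r →
              Sig T t v (δ v r + suc (toℕ i))
  Sig-intro v∈ root≡ = _ , v∈ , _ , root≡ , _ , δ-Dist , refl

module AdmissibleSequence {n l : ℕ} (T : Tree n) {t : Fin l → RSub n} (adm : Admissible T t) where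
  open TreeGeometry T

  private variable
    i j : Fin l
    v w r : Fin n
    m : ℕ

  disjoint : ∀ i j v → v ∈ verts (t i) → v ∈ verts (t j) → i ≡ j
  disjoint = proj₂ (proj₂ (proj₂ adm))

  root-exists : v ∈ verts (t i) → ∃[ r ] root (t i) ≡ just r
  root-exists {i = i} = proj₁ (proj₂ (proj₂ (proj₁ adm i))) _

  root-∈ : root (t i) ≡ just r → r ∈ verts (t i)
  root-∈ {i = i} = proj₁ (proj₂ (proj₁ adm i)) _

  block-connected : ∀ i → Connected (_∈ verts (t i))
  block-connected i = proj₂ (proj₂ (proj₂ (proj₁ adm i)))

  δ-root-across-edge : i ≢ j → w ∈ verts (t i) → v ∈ verts (t j) → w ⌢ v →
                       root (t i) ≡ just r → δ v r ≡ suc (δ w r)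
  δ-root-across-edge {i = i} i≢j w∈ v∈ w⌢v root≡ =
    δ-across-edge (_∈? verts (t i)) (block-connected i) (root-∈ root≡) w∈
                  (λ v∈ᵢ → i≢j (disjoint _ _ _ v∈ᵢ v∈)) w⌢v

  Sig⇒δ : v ∈ verts (t i) → root (t i) ≡ just r → Sig T t v m → m ≡ δ v r + suc (toℕ i)
  Sig⇒δ v∈ root≡ (i′ , v∈′ , _ , root≡′ , _ , D , m≡) with disjoint i′ _ _ v∈′ v∈
  ... | refl with just-injective (trans (sym root≡′) root≡)
  ...   | refl = trans m≡ (cong (_+ _) (Dist⇒δ D))

module Redistribution {n l : ℕ} (T : Tree n) (t : Fin l → RSub n) (i j : Fin l) (Rᵢ Rⱼ : RSub n)
  where

  redistributed : Fin l → RSub n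
  redistributed k with k ≟ᶠ i | k ≟ᶠ j
  ... | yes _ | _     = Rᵢ
  ... | no _  | yes _ = Rⱼ
  ... | no _  | no _  = t k

  redistributed-i : redistributed i ≡ Rᵢ
  redistributed-i with i ≟ᶠ i
  ... | yes _  = refl
  ... | no i≢i = ⊥-elim (i≢i refl)

  redistributed-j : i ≢ j → redistributed j ≡ Rⱼ
  redistributed-j i≢j with j ≟ᶠ i | j ≟ᶠ j
  ... | yes j≡i | _      = ⊥-elim (i≢j (sym j≡i))
  ... | no _    | yes _  = refl
  ... | no _    | no j≢j = ⊥-elim (j≢j refl)

  redistributed-k : ∀ {k} → k ≢ i → k ≢ j → redistributed k ≡ t k
  redistributed-k {k} k≢i k≢j with k ≟ᶠ i | k ≟ᶠ j
  ... | yes k≡i | _       = ⊥-elim (k≢i k≡i)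
  ... | no _    | yes k≡j = ⊥-elim (k≢j k≡j)
  ... | no _    | no _    = refl

  redistributed-admissible :
    Admissible T t → i ≢ j → IsRootedSubtree T Rᵢ → IsRootedSubtree T Rⱼ →
    (∀ x → (x ∈ verts Rᵢ ⊎ x ∈ verts Rⱼ) ⇔ (x ∈ verts (t i) ⊎ x ∈ verts (t j))) →
    (∀ x → x ∈ verts Rᵢ → x ∉ verts Rⱼ) →
    Admissible T redistributed
  redistributed-admissible (rooted , covers , branch , disjoint) i≢j
                           Rᵢ-rooted Rⱼ-rooted same Rᵢ∩Rⱼ=∅ =
    rooted′ , covers′ , branch′ , disjoint′
    where
    old : ∀ {x} → x ∈ verts Rᵢ ⊎ x ∈ verts Rⱼ → x ∈ verts (t i) ⊎ x ∈ verts (t j)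
    old = Equivalence.to (same _)

    old-branch : ∀ {x} → x ∈ verts (t i) ⊎ x ∈ verts (t j) → Branch T x
    old-branch (inj₁ x∈) = branch i _ x∈
    old-branch (inj₂ x∈) = branch j _ x∈

    elsewhere-absurd : ∀ {k x} {A : Set} → k ≢ i → k ≢ j → x ∈ verts (t k) →
                       x ∈ verts Rᵢ ⊎ x ∈ verts Rⱼ → A
    elsewhere-absurd k≢i k≢j x∈ moved with old moved
    ... | inj₁ x∈ᵢ = ⊥-elim (k≢i (disjoint _ _ _ x∈ x∈ᵢ))
    ... | inj₂ x∈ⱼ = ⊥-elim (k≢j (disjoint _ _ _ x∈ x∈ⱼ))

    rooted′ : ∀ k → IsRootedSubtree T (redistributed k)
    rooted′ k with k ≟ᶠ i | k ≟ᶠ j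
    ... | yes _ | _     = Rᵢ-rooted
    ... | no _  | yes _ = Rⱼ-rooted
    ... | no _  | no _  = rooted k

    branch′ : ∀ k x → x ∈ verts (redistributed k) → Branch T x
    branch′ k x with k ≟ᶠ i | k ≟ᶠ j
    ... | yes _ | _     = old-branch ∘ old ∘ inj₁
    ... | no _  | yes _ = old-branch ∘ old ∘ inj₂
    ... | no _  | no _  = branch k x

    moved : ∀ {x} → x ∈ verts Rᵢ ⊎ x ∈ verts Rⱼ → ∃[ k ] x ∈ verts (redistributed k)
    moved (inj₁ x∈) = i , subst (λ R → _ ∈ verts R) (sym redistributed-i) x∈
    moved (inj₂ x∈) = j , subst (λ R → _ ∈ verts R) (sym (redistributed-j i≢j)) x∈

    covers′ : ∀ x → Branch T x → ∃[ k ] x ∈ verts (redistributed k)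
    covers′ x bx with covers x bx
    ... | k , x∈ with k ≟ᶠ i | k ≟ᶠ j
    ...   | yes refl | _        = moved (Equivalence.from (same x) (inj₁ x∈))
    ...   | no _     | yes refl = moved (Equivalence.from (same x) (inj₂ x∈))
    ...   | no k≢i   | no k≢j   =
      k , subst (λ R → x ∈ verts R) (sym (redistributed-k k≢i k≢j)) x∈

    disjoint′ : ∀ k k′ x → x ∈ verts (redistributed k) → x ∈ verts (redistributed k′) →
                k ≡ k′
    disjoint′ k k′ x with k ≟ᶠ i | k ≟ᶠ j | k′ ≟ᶠ i | k′ ≟ᶠ j
    ... | yes refl | _        | yes refl | _        = λ _ _ → refl
    ... | yes refl | _        | no _     | yes refl = λ x∈ᵢ x∈ⱼ → ⊥-elim (Rᵢ∩Rⱼ=∅ x x∈ᵢ x∈ⱼ)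
    ... | yes refl | _        | no k′≢i  | no k′≢j  = λ x∈ᵢ x∈ → elsewhere-absurd k′≢i k′≢j x∈ (inj₁ x∈ᵢ)
    ... | no _     | yes refl | yes refl | _        = λ x∈ⱼ x∈ᵢ → ⊥-elim (Rᵢ∩Rⱼ=∅ x x∈ᵢ x∈ⱼ)
    ... | no _     | yes refl | no _     | yes refl = λ _ _ → refl
    ... | no _     | yes refl | no k′≢i  | no k′≢j  = λ x∈ⱼ x∈ → elsewhere-absurd k′≢i k′≢j x∈ (inj₂ x∈ⱼ)
    ... | no k≢i   | no k≢j   | yes refl | _        = λ x∈ x∈ᵢ → elsewhere-absurd k≢i k≢j x∈ (inj₁ x∈ᵢ)
    ... | no k≢i   | no k≢j   | no _     | yes refl = λ x∈ x∈ⱼ → elsewhere-absurd k≢i k≢j x∈ (inj₂ x∈ⱼ)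
    ... | no _     | no _     | no _     | no _     = disjoint k k′ x

module Reduce {n l : ℕ} (T : Tree n) {t : Fin l → RSub n} (adm : Admissible T t)
              {i j : Fin l} {w v : Fin n} (i<j : toℕ i < toℕ j)
              (w∈ : w ∈ verts (t i)) (v∈ : v ∈ verts (t j)) (w⌢v : Adj (E T) w v) where
  open TreeGeometry T
  open AdmissibleSequence T adm

  i≢j : i ≢ j
  i≢j = <⇒≢ᶠ i<j

  rᵢ : Fin n
  rᵢ = proj₁ (root-exists w∈)

  rootᵢ : root (t i) ≡ just rᵢ
  rootᵢ = proj₂ (root-exists w∈)

  rᵢ∈ : rᵢ ∈ verts (t i)
  rᵢ∈ = root-∈ rootᵢ

  rⱼ : Fin n
  rⱼ = proj₁ (root-exists v∈)

  rootⱼ : root (t j) ≡ just rⱼ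
  rootⱼ = proj₂ (root-exists v∈)

  rⱼ∈ : rⱼ ∈ verts (t j)
  rⱼ∈ = root-∈ rootⱼ

  inSᵢ? : Decidable (λ u → u ∈ verts (t i) ⊎ InDesc T (t j) v u)
  inSᵢ? u = (u ∈? verts (t i)) ⊎-dec InDesc? (t j) rootⱼ v u

  inSⱼ? : Decidable (λ u → u ∈ verts (t j) × ¬ InDesc T (t j) v u)
  inSⱼ? u = (u ∈? verts (t j)) ×-dec ¬? (InDesc? (t j) rootⱼ v u)

  Sᵢ : Subset n
  Sᵢ = subsetOf inSᵢ?

  Sⱼ : Subset n
  Sⱼ = subsetOf inSⱼ?

  to-Sᵢ : ∀ {u} → u ∈ verts (t i) ⊎ InDesc T (t j) v u → u ∈ Sᵢ
  to-Sᵢ = Equivalence.from (∈-subsetOf inSᵢ?)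

  from-Sᵢ : ∀ {u} → u ∈ Sᵢ → u ∈ verts (t i) ⊎ InDesc T (t j) v u
  from-Sᵢ = Equivalence.to (∈-subsetOf inSᵢ?)

  to-Sⱼ : ∀ {u} → u ∈ verts (t j) × ¬ InDesc T (t j) v u → u ∈ Sⱼ
  to-Sⱼ = Equivalence.from (∈-subsetOf inSⱼ?)

  from-Sⱼ : ∀ {u} → u ∈ Sⱼ → u ∈ verts (t j) × ¬ InDesc T (t j) v u
  from-Sⱼ = Equivalence.to (∈-subsetOf inSⱼ?)

  v∈Sᵢ : v ∈ Sᵢ
  v∈Sᵢ = to-Sᵢ (inj₂ (InDesc-self rootⱼ v∈))

  -- When v is the root of t j the whole block moves, leaving the empty rooted tree.
  cut-root : Dec (rⱼ ≡ v) → Maybe (Fin n)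
  cut-root (yes _) = nothing
  cut-root (no _)  = just rⱼ

  Rᵢ : RSub n
  Rᵢ = rsub Sᵢ (just rᵢ)

  Rⱼ : RSub n
  Rⱼ = rsub Sⱼ (cut-root (rⱼ ≟ᶠ v))

  open Redistribution T t i j Rᵢ Rⱼ

  Rᵢ-rooted : IsRootedSubtree T Rᵢ
  Rᵢ-rooted = rooted-star (to-Sᵢ (inj₁ rᵢ∈)) star
    where
    from-tᵢ : ∀ {a b} → WalkIn G (_∈ verts (t i)) a b → WalkIn G (_∈ Sᵢ) a b
    from-tᵢ = walkIn-map (to-Sᵢ ∘ inj₁)
    star : ∀ u → u ∈ Sᵢ → WalkIn G (_∈ Sᵢ) u rᵢ
    star u u∈ with from-Sᵢ u∈
    ... | inj₁ u∈ᵢ    = from-tᵢ (block-connected i u rᵢ u∈ᵢ rᵢ∈)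
    ... | inj₂ u-desc = walkIn-++
      (walkIn-map (to-Sᵢ ∘ inj₂) (descendants-connected (block-connected j) rootⱼ v∈ u-desc))
      (step v∈Sᵢ (⌢-sym w⌢v) (from-tᵢ (block-connected i w rᵢ w∈ rᵢ∈)))

  Rⱼ-rooted : IsRootedSubtree T (rsub Sⱼ (cut-root (rⱼ ≟ᶠ v)))
  Rⱼ-rooted with rⱼ ≟ᶠ v
  ... | yes rⱼ≡v = rooted-empty λ u u∈ → let (u∈ⱼ , u-not-desc) = from-Sⱼ u∈ in
    u-not-desc (subst (λ x → InDesc T (t j) x u) rⱼ≡v (InDesc-root rootⱼ u∈ⱼ))
  ... | no rⱼ≢v  = rooted-star (to-Sⱼ (rⱼ∈ , rⱼ≢v ∘ sym ∘ root-InDesc rootⱼ)) λ u u∈ →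
    walkIn-map to-Sⱼ (uncurry (remainder-connected (block-connected j) rootⱼ rⱼ∈) (from-Sⱼ u∈))

  same-vertices : ∀ x → (x ∈ Sᵢ ⊎ x ∈ Sⱼ) ⇔ (x ∈ verts (t i) ⊎ x ∈ verts (t j))
  same-vertices x = mk⇔ to from
    where
    to : x ∈ Sᵢ ⊎ x ∈ Sⱼ → x ∈ verts (t i) ⊎ x ∈ verts (t j)
    to (inj₁ x∈) with from-Sᵢ x∈
    ... | inj₁ x∈ᵢ    = inj₁ x∈ᵢ
    ... | inj₂ x-desc = inj₂ (proj₁ x-desc)
    to (inj₂ x∈) = inj₂ (proj₁ (from-Sⱼ x∈))
    from : x ∈ verts (t i) ⊎ x ∈ verts (t j) → x ∈ Sᵢ ⊎ x ∈ Sⱼ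
    from (inj₁ x∈ᵢ) = inj₁ (to-Sᵢ (inj₁ x∈ᵢ))
    from (inj₂ x∈ⱼ) with InDesc? (t j) rootⱼ v x
    ... | yes x-desc    = inj₁ (to-Sᵢ (inj₂ x-desc))
    ... | no x-not-desc = inj₂ (to-Sⱼ (x∈ⱼ , x-not-desc))

  Sᵢ∩Sⱼ=∅ : ∀ x → x ∈ Sᵢ → x ∉ Sⱼ
  Sᵢ∩Sⱼ=∅ x x∈ᵢ x∈ⱼ with from-Sᵢ x∈ᵢ | from-Sⱼ x∈ⱼ
  ... | inj₁ x∈tᵢ   | x∈tⱼ , _       = i≢j (disjoint _ _ _ x∈tᵢ x∈tⱼ)
  ... | inj₂ x-desc | _ , x-not-desc = x-not-desc x-desc

  keeps-root : root (t j) ≢ just v → root (redistributed j) ≡ root (t j)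
  keeps-root root≢v = trans (cong root (redistributed-j i≢j)) (kept (rⱼ ≟ᶠ v))
    where
    kept : (d : Dec (rⱼ ≡ v)) → cut-root d ≡ root (t j)
    kept (yes rⱼ≡v) = ⊥-elim (root≢v (trans rootⱼ (cong just rⱼ≡v)))
    kept (no _)     = sym rootⱼ

  ∈-redistributed-i : ∀ u → u ∈ verts (redistributed i) ⇔
                              (u ∈ verts (t i) ⊎ InDesc T (t j) v u)
  ∈-redistributed-i u =
    subst (λ R → u ∈ verts R ⇔ _) (sym redistributed-i) (∈-subsetOf inSᵢ?)

  ∈-redistributed-j : ∀ u → u ∈ verts (redistributed j) ⇔
                              (u ∈ verts (t j) × ¬ InDesc T (t j) v u)
  ∈-redistributed-j u =
    subst (λ R → u ∈ verts R ⇔ _) (sym (redistributed-j i≢j)) (∈-subsetOf inSⱼ?)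

  reducible : ∀ {a b} → Sig T t v a → Sig T t w b → a ≡ suc b →
              Σ (Fin l → RSub n) λ s → Admissible T s × Reduction T s t
  reducible {a} {b} sig-v sig-w a≡1+b =
      redistributed
    , redistributed-admissible adm i≢j Rᵢ-rooted Rⱼ-rooted same-vertices Sᵢ∩Sⱼ=∅
    , i , j , w , v , i<j , w∈ , v∈ , w⌢v , (λ _ → redistributed-k)
    , trans (cong root redistributed-i) (sym rootᵢ) , keeps-root
    , ∈-redistributed-i , ∈-redistributed-j
    , a , subst (Sig T redistributed v) (sym a≡) (Sig-intro v∈sᵢ (cong root redistributed-i))
    , sig-v
    where
    open ≡-Reasoning
    v∈sᵢ : v ∈ verts (redistributed i)
    v∈sᵢ = Equivalence.from (∈-redistributed-i v) (inj₂ (InDesc-self rootⱼ v∈))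
    δv≡1+δw : δ v rᵢ ≡ suc (δ w rᵢ)
    δv≡1+δw = δ-root-across-edge i≢j w∈ v∈ w⌢v rootᵢ
    a≡ : a ≡ δ v rᵢ + suc (toℕ i)
    a≡ = begin
      a                           ≡⟨ a≡1+b ⟩
      suc b                       ≡⟨ cong suc (Sig⇒δ w∈ rootᵢ sig-w) ⟩
      suc (δ w rᵢ) + suc (toℕ i)  ≡⟨ cong (_+ suc (toℕ i)) δv≡1+δw ⟨
      δ v rᵢ + suc (toℕ i)        ∎

canonical⇒irreducible : ∀ {n l} (T : Tree n) {t : Fin l → RSub n} → Admissible T t →
                        Canonical T t →
                        ¬ (Σ (Fin l → RSub n) λ s → Admissible T s × Reduction T s t)
canonical⇒irreducible {n} T {t} adm canonical
  (s , adm-s , i , j , w , v , i<j , w∈ , v∈ , w⌢v , _ , root-sᵢ , _ , ∈sᵢ , _ , m , sig-s , sig-t)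
  =
  canonical (i , j , w , v , m , _ , i<j , w∈ , v∈ , w⌢v , sig-t , Sig-intro w∈ rootᵢ , m≡)
  where
  open TreeGeometry T
  open AdmissibleSequence T adm
  rᵢ : Fin n
  rᵢ = proj₁ (root-exists w∈)
  rootᵢ : root (t i) ≡ just rᵢ
  rootᵢ = proj₂ (root-exists w∈)
  v∈sᵢ : v ∈ verts (s i)
  v∈sᵢ = Equivalence.from (∈sᵢ v) (inj₂ (InDesc-self (proj₂ (root-exists v∈)) v∈))
  m≡ : m ≡ suc (δ w rᵢ + suc (toℕ i))
  m≡ = trans (AdmissibleSequence.Sig⇒δ T adm-s v∈sᵢ (trans root-sᵢ rootᵢ) sig-s)
             (cong (_+ suc (toℕ i)) (δ-root-across-edge (<⇒≢ᶠ i<j) w∈ v∈ w⌢v rootᵢ))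

lemma3p9 : (n : ℕ) (T : Tree n) → HomeoIrreducible T →
    (l : ℕ) (t : Fin l → RSub n) → Admissible T t →
    (¬ (Σ (Fin l → RSub n) λ s → Admissible T s × Reduction T s t))
      ⇔ Canonical T t
lemma3p9 n T _ l t adm = mk⇔ irreducible⇒canonical (canonical⇒irreducible T adm)
  where
  irreducible⇒canonical : ¬ (Σ (Fin l → RSub n) λ s → Admissible T s × Reduction T s t) →
                          Canonical T t
  irreducible⇒canonical irreducible
    (_ , _ , _ , _ , _ , _ , i<j , w∈ , v∈ , w⌢v , sig-v , sig-w , a≡1+b) =
    irreducible (Reduce.reducible T adm i<j w∈ v∈ w⌢v sig-v sig-w a≡1+b)
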